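{- Let $0\le k\le k+p<n$, let $A=a_1\cdots a_n$ be a binary string with $k\le w(A)\le k+p+1$, let $A^\infty=a_1a_2\cdots$ be generated from $A$ by the symmetric shift register with parameters $k,p,n$, and let $w_r=a_{r+1}+\cdots+a_{r+n}-k$ for $r\ge0$. Suppose $a_{r+i}=1$ for $1\le i\le q$, where $r\ge0$ and $q\ge1$, and let $s=\min\{q,w_r\}$. Then: (a) $w_{r+i}=w_r-i$ for $0\le i\le s$, and $a_{r+n+i}=0$ for $1\le i\le s$; (b) if $s<q$, then $w_{r+i}=0$ for $s\le i\le q$, and $a_{r+n+i}=1$ for $s<i\le q$; (c) $w_{r+q}=w_r-s$ and $a_{r+n+1}\cdots a_{r+n+q}=1\!\!\!\;$ consists of $s$ zeros followed by $q-s$ ones, i.e. $a_{r+n+1}\cdots a_{r+n+q}=0_s1_{q-s}$.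
   Context: $w(A)$ is the number of 1's in $A$; $0_j$, $1_j$ denote $j$ consecutive 0's or 1's (empty if $j=0$). The symmetric shift register with parameters $k,p,n$ generates $A^\infty=a_1a_2\cdots$ from $A$ by: for $i\ge0$, $a_{n+i+1}=1-a_{i+1}$ if $k\le a_{i+2}+\cdots+a_{i+n}\le k+p$, and $a_{n+i+1}=a_{i+1}$ otherwise. -}

module Defs where

open import Data.Bool using (Bool; true; false; not; _∧_; if_then_else_)
open import Data.Nat using (ℕ; zero; suc; _+_; _≤ᵇ_)
open import Data.List using (List; []; _∷_; _++_; [_]; map; upTo)
open import Data.Nat.ListAction using (sum)
open import Data.Vec using (Vec; toList)
open import Data.Integer using (ℤ; +_; _-_)

bit : Bool → ℕ
bit true  = 1
bit false = 0

w : ∀ {n} → Vec Bool n → ℕ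
w A = sum (map bit (toList A))

-- one step of the symmetric shift register with parameters k, p, acting on the
-- current window a_{i+1} ⋯ a_{i+n}: drop a_{i+1} and append a_{n+i+1}, where
-- a_{n+i+1} = 1 - a_{i+1} if k ≤ a_{i+2}+⋯+a_{i+n} ≤ k+p, and a_{i+1} otherwise.
step : ℕ → ℕ → List Bool → List Bool
step k p []         = []
step k p (x ∷ rest) =
  rest ++ [ (if (k ≤ᵇ s) ∧ (s ≤ᵇ k + p) then not x else x) ]
  where s = sum (map bit rest)

window : ∀ {n} → ℕ → ℕ → Vec Bool n → ℕ → List Bool
window k p A zero    = toList A
window k p A (suc r) = step k p (window k p A r)

headBit : List Bool → ℕ
headBit []      = 0
headBit (x ∷ _) = bit x

-- the generated sequence A^∞ = a_1 a_2 ⋯ (1-indexed; index 0 is unused and set to 0):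
-- a_{r+1} is the first entry of the r-th window.
seq : ∀ {n} → ℕ → ℕ → Vec Bool n → ℕ → ℕ
seq k p A zero    = 0
seq k p A (suc r) = headBit (window k p A r)

blockSum : (ℕ → ℕ) → ℕ → ℕ → ℕ
blockSum f r zero    = 0
blockSum f r (suc n) = blockSum f r n + f (r + suc n)

wr : ∀ {n} → ℕ → ℕ → Vec Bool n → ℕ → ℤ
wr {n} k p A r = + blockSum (seq k p A) r n - + k

block : (ℕ → ℕ) → ℕ → ℕ → List ℕ
block f r q = map (λ i → f (r + suc i)) (upTo q)

-- Every window a_{r+1} ⋯ a_{r+n} has between k and k+p+1 ones, an invariant
-- of the register. Let the window start with a 1. If it has more than k ones,
-- the other n-1 bits have between k and k+p ones, so the 1 is flipped: a 0 is
-- appended and w_r drops by one. If it has exactly k ones, the other bits have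
-- k-1 ones, so the 1 is copied and w_r stays 0. As the run of q ones passes
-- the front of the window, the register thus emits min(q, w_r) zeros, then ones.
module Submission where

open import Defs
open import Data.Bool using (Bool; true; false; not; T)
open import Data.Bool.Properties using (T-≡)
open import Data.Nat using (ℕ; zero; suc; pred; _+_; _≤_; _<_; _∸_; _⊔_; _≤ᵇ_; z≤n; s≤s; _≤?_; _<?_) renaming (_⊓_ to _⊓ℕ_)
open import Data.Nat.Properties
open import Data.Nat.ListAction using (sum)
open import Data.Nat.ListAction.Properties using (sum-++)
open import Data.Nat.Tactic.RingSolver using (solve-∀)
open import Data.Integer using (+_; _-_; _⊓_; ∣_∣; +≤+; +<+) renaming (_≤_ to _≤ℤ_; _<_ to _<ℤ_)
open import Data.Integer.Properties using (m-n≡m⊖n; ⊖-≥)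
open import Data.List using (List; []; _∷_; _++_; [_]; map; length; replicate; applyUpTo)
open import Data.List.Properties using (length-++; map-++; map-upTo)
open import Data.Vec using (Vec)
open import Data.Vec.Properties using (length-toList)
open import Data.Product using (_×_; _,_; proj₁; proj₂; map₂)
open import Data.Sum using (inj₁; inj₂)
open import Function using (_∘_)
open import Function.Bundles using (Equivalence)
open import Relation.Nullary using (yes; no; ¬_; contradiction)
open import Relation.Binary.PropositionalEquality using (_≡_; refl; sym; trans; cong; cong₂; subst)
open Relation.Binary.PropositionalEquality.≡-Reasoning

weight : List Bool → ℕ
weight L = sum (map bit L)

bit≤1 : ∀ b → bit b ≤ 1
bit≤1 true  = ≤-refl
bit≤1 false = z≤n

weight-∷ʳ : ∀ xs b → weight (xs ++ [ b ]) ≡ weight xs + bit b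
weight-∷ʳ xs b = begin
  sum (map bit (xs ++ [ b ]))          ≡⟨ cong sum (map-++ bit xs [ b ]) ⟩
  sum (map bit xs ++ [ bit b ])        ≡⟨ sum-++ (map bit xs) [ bit b ] ⟩
  weight xs + (bit b + 0)              ≡⟨ cong (λ t → weight xs + t) (+-identityʳ (bit b)) ⟩
  weight xs + bit b                    ∎

weight-rotate : ∀ x xs → weight (xs ++ [ x ]) ≡ weight (x ∷ xs)
weight-rotate x xs = trans (weight-∷ʳ xs x) (+-comm (weight xs) (bit x))

bitAt : List Bool → ℕ → ℕ
bitAt []       _       = 0
bitAt (x ∷ _)  zero    = bit x
bitAt (_ ∷ xs) (suc j) = bitAt xs j

bitAt-zero : ∀ L → bitAt L 0 ≡ headBit L
bitAt-zero []      = refl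
bitAt-zero (_ ∷ _) = refl

bitAt-++ˡ : ∀ xs ys j → j < length xs → bitAt (xs ++ ys) j ≡ bitAt xs j
bitAt-++ˡ (x ∷ xs) ys zero    _         = refl
bitAt-++ˡ (x ∷ xs) ys (suc j) (s≤s j<) = bitAt-++ˡ xs ys j j<

bitAt-∷ʳ-last : ∀ xs b → bitAt (xs ++ [ b ]) (length xs) ≡ bit b
bitAt-∷ʳ-last []       b = refl
bitAt-∷ʳ-last (_ ∷ xs) b = bitAt-∷ʳ-last xs b

blockSum-suc : ∀ f r n → blockSum f r (suc n) ≡ f (suc r) + blockSum f (suc r) n
blockSum-suc f r zero    = trans (cong f (+-comm r 1)) (sym (+-identityʳ (f (suc r))))
blockSum-suc f r (suc n) = begin
  blockSum f r (suc n) + f (r + suc (suc n))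
    ≡⟨ cong₂ _+_ (blockSum-suc f r n) (cong f (+-suc r (suc n))) ⟩
  f (suc r) + blockSum f (suc r) n + f (suc r + suc n)
    ≡⟨ +-assoc (f (suc r)) (blockSum f (suc r) n) (f (suc r + suc n)) ⟩
  f (suc r) + blockSum f (suc r) (suc n) ∎

blockSum-weight : ∀ f r L → (∀ j → j < length L → f (r + suc j) ≡ bitAt L j) →
  blockSum f r (length L) ≡ weight L
blockSum-weight f r []       _  = refl
blockSum-weight f r (x ∷ xs) fL = begin
  blockSum f r (suc (length xs))              ≡⟨ blockSum-suc f r (length xs) ⟩
  f (suc r) + blockSum f (suc r) (length xs)  ≡⟨ cong₂ _+_ f-head (blockSum-weight f (suc r) xs f-tail) ⟩
  bit x + weight xs                           ∎
  where
  f-head : f (suc r) ≡ bit x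
  f-head = trans (cong f (+-comm 1 r)) (fL 0 (s≤s z≤n))
  f-tail : ∀ j → j < length xs → f (suc r + suc j) ≡ bitAt xs j
  f-tail j j< = trans (cong f (sym (+-suc r (suc j)))) (fL (suc j) (s≤s j<))

+m-+n≡+[m∸n] : ∀ {m n} → n ≤ m → + m - + n ≡ + (m ∸ n)
+m-+n≡+[m∸n] {m} {n} n≤m = trans (m-n≡m⊖n m n) (⊖-≥ n≤m)

m+[n∸o]≡m : ∀ m {n o} → n ≤ o → m + (n ∸ o) ≡ m
m+[n∸o]≡m m n≤o = trans (cong (λ t → m + t) (m≤n⇒m∸n≡0 n≤o)) (+-identityʳ m)

m∸[n⊓m]≡m∸n : ∀ m n → m ∸ (n ⊓ℕ m) ≡ m ∸ n
m∸[n⊓m]≡m∸n m n = begin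
  m ∸ (n ⊓ℕ m)       ≡⟨ ∸-distribˡ-⊓-⊔ m n m ⟩
  (m ∸ n) ⊔ (m ∸ m)  ≡⟨ cong ((m ∸ n) ⊔_) (n∸n≡0 m) ⟩
  (m ∸ n) ⊔ 0        ≡⟨ ⊔-identityʳ (m ∸ n) ⟩
  m ∸ n              ∎

module Register (k p : ℕ) where

  private
    ≤⇒≤ᵇ≡true : ∀ {m n} → m ≤ n → (m ≤ᵇ n) ≡ true
    ≤⇒≤ᵇ≡true = Equivalence.to T-≡ ∘ ≤⇒≤ᵇ

    ≰⇒≤ᵇ≡false : ∀ {m n} → ¬ m ≤ n → (m ≤ᵇ n) ≡ false
    ≰⇒≤ᵇ≡false {m} {n} m≰n with m ≤ᵇ n in eq
    ... | false = refl
    ... | true  = contradiction (≤ᵇ⇒≤ m n (subst T (sym eq) _)) m≰n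

  step-flip : ∀ x rest → k ≤ weight rest → weight rest ≤ k + p →
    step k p (x ∷ rest) ≡ rest ++ [ not x ]
  step-flip x rest lo hi rewrite ≤⇒≤ᵇ≡true lo | ≤⇒≤ᵇ≡true hi = refl

  step-keep-below : ∀ x rest → weight rest < k → step k p (x ∷ rest) ≡ rest ++ [ x ]
  step-keep-below x rest w<k rewrite ≰⇒≤ᵇ≡false (<⇒≱ w<k) = refl

  step-keep-above : ∀ x rest → k + p < weight rest → step k p (x ∷ rest) ≡ rest ++ [ x ]
  step-keep-above x rest w>kp
    rewrite ≤⇒≤ᵇ≡true (≤-trans (m≤m+n k p) (<⇒≤ w>kp)) | ≰⇒≤ᵇ≡false (<⇒≱ w>kp) = refl

  length-step : ∀ L → length (step k p L) ≡ length L
  length-step []         = refl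
  length-step (x ∷ rest) = trans (length-++ rest) (+-comm (length rest) 1)

  bitAt-step : ∀ L j → suc j < length L → bitAt (step k p L) j ≡ bitAt L (suc j)
  bitAt-step (x ∷ rest) j (s≤s j<) = bitAt-++ˡ rest _ j j<

  step-preserves-bounds : ∀ L → k ≤ weight L → weight L ≤ suc (k + p) →
    k ≤ weight (step k p L) × weight (step k p L) ≤ suc (k + p)
  step-preserves-bounds []         lo hi = lo , hi
  step-preserves-bounds (x ∷ rest) lo hi with k ≤? weight rest | weight rest ≤? k + p
  ... | no k≰w | _
    rewrite step-keep-below x rest (≰⇒> k≰w) | weight-rotate x rest = lo , hi
  ... | yes _ | no w≰kp
    rewrite step-keep-above x rest (≰⇒> w≰kp) | weight-rotate x rest = lo , hi
  ... | yes k≤w | yes w≤kp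
    rewrite step-flip x rest k≤w w≤kp | weight-∷ʳ rest (not x) =
      ≤-trans k≤w (m≤m+n (weight rest) _) ,
      ≤-trans (+-monoʳ-≤ (weight rest) (bit≤1 (not x)))
              (subst (_≤ suc (k + p)) (+-comm 1 (weight rest)) (s≤s w≤kp))

  step-one-above : ∀ L → headBit L ≡ 1 → k < weight L → weight L ≤ suc (k + p) →
    suc (weight (step k p L)) ≡ weight L × bitAt (step k p L) (pred (length L)) ≡ 0
  step-one-above (true ∷ rest) _ (s≤s lo) (s≤s hi) rewrite step-flip true rest lo hi =
    cong suc (trans (weight-∷ʳ rest false) (+-identityʳ (weight rest))) ,
    bitAt-∷ʳ-last rest false

  step-one-at : ∀ L → headBit L ≡ 1 → weight L ≡ k →
    weight (step k p L) ≡ k × bitAt (step k p L) (pred (length L)) ≡ 1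
  step-one-at (true ∷ rest) _ refl rewrite step-keep-below true rest ≤-refl =
    weight-rotate true rest , bitAt-∷ʳ-last rest true

module Generated (k p : ℕ) {n} (A : Vec Bool n) where

  open Register k p

  length-window : ∀ r → length (window k p A r) ≡ n
  length-window zero    = length-toList A
  length-window (suc r) = trans (length-step (window k p A r)) (length-window r)

  bitAt-window : ∀ r j → j < n → bitAt (window k p A r) j ≡ seq k p A (r + suc j)
  bitAt-window r zero    _   = trans (bitAt-zero (window k p A r)) (cong (seq k p A) (+-comm 1 r))
  bitAt-window r (suc j) j<n = begin
    bitAt (window k p A r) (suc j)
      ≡⟨ bitAt-step (window k p A r) j (subst (suc j <_) (sym (length-window r)) j<n) ⟨
    bitAt (window k p A (suc r)) j       ≡⟨ bitAt-window (suc r) j (<⇒≤ j<n) ⟩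
    seq k p A (suc r + suc j)            ≡⟨ cong (seq k p A) (+-suc r (suc j)) ⟨
    seq k p A (r + suc (suc j))          ∎

  blockSum-window : ∀ r → blockSum (seq k p A) r n ≡ weight (window k p A r)
  blockSum-window r = begin
    blockSum (seq k p A) r n                            ≡⟨ cong (blockSum (seq k p A) r) (length-window r) ⟨
    blockSum (seq k p A) r (length (window k p A r))  ≡⟨ blockSum-weight (seq k p A) r (window k p A r) seq≡bitAt ⟩
    weight (window k p A r)                             ∎
    where
    seq≡bitAt : ∀ j → j < length (window k p A r) → seq k p A (r + suc j) ≡ bitAt (window k p A r) j
    seq≡bitAt j j< = sym (bitAt-window r j (subst (j <_) (length-window r) j<))

  window-bounds : k ≤ w A → w A ≤ suc (k + p) →
    ∀ r → k ≤ weight (window k p A r) × weight (window k p A r) ≤ suc (k + p)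
  window-bounds lo hi zero    = lo , hi
  window-bounds lo hi (suc r) =
    let lo′ , hi′ = window-bounds lo hi r in step-preserves-bounds (window k p A r) lo′ hi′

  wr-window : ∀ r x → weight (window k p A r) ≡ k + x → wr k p A r ≡ + x
  wr-window r x eq = begin
    + blockSum (seq k p A) r n - + k  ≡⟨ cong (λ t → + t - + k) (trans (blockSum-window r) eq) ⟩
    + (k + x) - + k                   ≡⟨ +m-+n≡+[m∸n] (m≤m+n k x) ⟩
    + (k + x ∸ k)                     ≡⟨ cong +_ (m+n∸m≡n k x) ⟩
    + x                               ∎

applyUpTo-const : ∀ (h : ℕ → ℕ) q c → (∀ j → j < q → h j ≡ c) → applyUpTo h q ≡ replicate q c
applyUpTo-const h zero    c _  = refl
applyUpTo-const h (suc q) c hc =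
  cong₂ _∷_ (hc 0 (s≤s z≤n)) (applyUpTo-const (h ∘ suc) q c (λ j j< → hc (suc j) (s≤s j<)))

applyUpTo-threshold : ∀ (h : ℕ → ℕ) q v →
  (∀ j → j < q → j < v → h j ≡ 0) → (∀ j → j < q → v ≤ j → h j ≡ 1) →
  applyUpTo h q ≡ replicate (q ⊓ℕ v) 0 ++ replicate (q ∸ (q ⊓ℕ v)) 1
applyUpTo-threshold h zero    v       _  _  = refl
applyUpTo-threshold h (suc q) zero    _  h1 = applyUpTo-const h (suc q) 1 (λ j j< → h1 j j< z≤n)
applyUpTo-threshold h (suc q) (suc v) h0 h1 =
  cong₂ _∷_ (h0 0 (s≤s z≤n) (s≤s z≤n))
    (applyUpTo-threshold (h ∘ suc) q v (λ j j<q j<v → h0 (suc j) (s≤s j<q) (s≤s j<v))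
                                       (λ j j<q v≤j → h1 (suc j) (s≤s j<q) (s≤s v≤j)))

m⊓n<m⇒m⊓n≡n : ∀ {m n} → m ⊓ℕ n < m → m ⊓ℕ n ≡ n
m⊓n<m⇒m⊓n≡n {m} {n} m⊓n<m with ⊓-sel m n
... | inj₁ m⊓n≡m = contradiction (subst (_< m) m⊓n≡m m⊓n<m) (<-irrefl refl)
... | inj₂ m⊓n≡n = m⊓n≡n

module Run (k p n′ : ℕ) (A : Vec Bool (suc n′)) (lo : k ≤ w A) (hi : w A ≤ k + p + 1)
           (r q : ℕ) (ones : ∀ i → 1 ≤ i → i ≤ q → seq k p A (r + i) ≡ 1) where

  open Register k p
  open Generated k p A

  private
    n : ℕ
    n = suc n′

    W : ℕ → ℕ
    W m = weight (window k p A m)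

    a : ℕ → ℕ
    a = seq k p A

    hi′ : w A ≤ suc (k + p)
    hi′ = subst (w A ≤_) (+-comm (k + p) 1) hi

  v : ℕ
  v = W r ∸ k

  private
    W-r : W r ≡ k + v
    W-r = sym (m+[n∸m]≡n (proj₁ (window-bounds lo hi′ r)))

  wr-start : wr k p A r ≡ + v
  wr-start = wr-window r v W-r

  head-one : ∀ i → i < q → headBit (window k p A (r + i)) ≡ 1
  head-one i i<q = trans (cong a (sym (+-suc r i))) (ones (suc i) (s≤s z≤n) i<q)

  appended : ∀ i → bitAt (window k p A (suc (r + i))) (pred (length (window k p A (r + i))))
                     ≡ a (r + n + suc i)
  appended i rewrite length-window (r + i) =
    trans (bitAt-window (suc (r + i)) n′ ≤-refl) (cong a (shift r i n′))
    where
    shift : ∀ r i m → suc (r + i) + suc m ≡ r + suc m + suc i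
    shift = solve-∀

  weight-run : ∀ i → i ≤ q → W (r + i) ≡ k + (v ∸ i)
  weight-above : ∀ i → i < q → i < v → W (r + i) ≡ suc (k + (v ∸ suc i))
  weight-at : ∀ i → i ≤ q → v ≤ i → W (r + i) ≡ k

  step-above : ∀ i → i < q → i < v → suc (W (suc (r + i))) ≡ W (r + i) × a (r + n + suc i) ≡ 0
  step-above i i<q i<v = map₂ (trans (sym (appended i)))
    (step-one-above (window k p A (r + i)) (head-one i i<q)
      (subst (k <_) (sym (weight-above i i<q i<v)) (s≤s (m≤m+n k _)))
      (proj₂ (window-bounds lo hi′ (r + i))))

  step-at : ∀ i → i < q → v ≤ i → W (suc (r + i)) ≡ k × a (r + n + suc i) ≡ 1
  step-at i i<q v≤i = map₂ (trans (sym (appended i)))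
    (step-one-at (window k p A (r + i)) (head-one i i<q) (weight-at i (<⇒≤ i<q) v≤i))

  weight-run zero    _   = trans (cong W (+-identityʳ r)) W-r
  weight-run (suc i) i<q with i <? v
  ... | yes i<v = trans (cong W (+-suc r i))
                    (suc-injective (trans (proj₁ (step-above i i<q i<v)) (weight-above i i<q i<v)))
  ... | no  i≮v = trans (cong W (+-suc r i))
                    (trans (proj₁ (step-at i i<q v≤i)) (sym (m+[n∸o]≡m k (≤-trans v≤i (n≤1+n i)))))
    where
    v≤i : v ≤ i
    v≤i = ≮⇒≥ i≮v

  weight-above i i<q i<v = begin
    W (r + i)              ≡⟨ weight-run i (<⇒≤ i<q) ⟩
    k + (v ∸ i)            ≡⟨ cong (λ t → k + t) (+-∸-assoc 1 i<v) ⟩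
    k + suc (v ∸ suc i)    ≡⟨ +-suc k (v ∸ suc i) ⟩
    suc (k + (v ∸ suc i))  ∎

  weight-at i i≤q v≤i = trans (weight-run i i≤q) (m+[n∸o]≡m k v≤i)

  emits-zero : ∀ i → i < q → i < v → a (r + n + suc i) ≡ 0
  emits-zero i i<q i<v = proj₂ (step-above i i<q i<v)

  emits-one : ∀ i → i < q → v ≤ i → a (r + n + suc i) ≡ 1
  emits-one i i<q v≤i = proj₂ (step-at i i<q v≤i)

  wr-run : ∀ i → i ≤ q → wr k p A (r + i) ≡ + (v ∸ i)
  wr-run i i≤q = wr-window (r + i) (v ∸ i) (weight-run i i≤q)

  wr-decreases : ∀ i → + i ≤ℤ + q ⊓ + v → wr k p A (r + i) ≡ + v - + i
  wr-decreases i (+≤+ i≤s) =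
    trans (wr-run i (≤-trans i≤s (m⊓n≤m q v))) (sym (+m-+n≡+[m∸n] (≤-trans i≤s (m⊓n≤n q v))))

  emits-zeros : ∀ i → 1 ≤ i → + i ≤ℤ + q ⊓ + v → a (r + n + i) ≡ 0
  emits-zeros (suc i) _ (+≤+ i<s) = emits-zero i (<-≤-trans i<s (m⊓n≤m q v)) (<-≤-trans i<s (m⊓n≤n q v))

  after-zeros : + q ⊓ + v <ℤ + q →
    (∀ i → + q ⊓ + v ≤ℤ + i → i ≤ q → wr k p A (r + i) ≡ + 0)
      × (∀ i → + q ⊓ + v <ℤ + i → i ≤ q → a (r + n + i) ≡ 1)
  after-zeros (+<+ s<q) = wr-zero , emits-ones
    where
    s≡v : q ⊓ℕ v ≡ v
    s≡v = m⊓n<m⇒m⊓n≡n s<q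

    wr-zero : ∀ i → + q ⊓ + v ≤ℤ + i → i ≤ q → wr k p A (r + i) ≡ + 0
    wr-zero i (+≤+ s≤i) i≤q = trans (wr-run i i≤q) (cong +_ (m≤n⇒m∸n≡0 (subst (_≤ i) s≡v s≤i)))

    emits-ones : ∀ i → + q ⊓ + v <ℤ + i → i ≤ q → a (r + n + i) ≡ 1
    emits-ones (suc i) (+<+ s<1+i) i<q = emits-one i i<q (≤-pred (subst (_< suc i) s≡v s<1+i))

  wr-end : wr k p A (r + q) ≡ + v - + q ⊓ + v
  wr-end = begin
    wr k p A (r + q)   ≡⟨ wr-run q ≤-refl ⟩
    + (v ∸ q)          ≡⟨ cong +_ (m∸[n⊓m]≡m∸n v q) ⟨
    + (v ∸ (q ⊓ℕ v))   ≡⟨ +m-+n≡+[m∸n] (m⊓n≤n q v) ⟨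
    + v - + q ⊓ + v    ∎

  output-block : block a (r + n) q ≡ replicate (q ⊓ℕ v) 0 ++ replicate (q ∸ (q ⊓ℕ v)) 1
  output-block =
    trans (map-upTo (λ i → a (r + n + suc i)) q) (applyUpTo-threshold _ q v emits-zero emits-one)

proposition42p2 : (k p n : ℕ) → k + p < n → (A : Vec Bool n) →
    k ≤ w A → w A ≤ k + p + 1 →
    (r q : ℕ) → 1 ≤ q → (∀ i → 1 ≤ i → i ≤ q → seq k p A (r + i) ≡ 1) →
    let s = + q ⊓ wr k p A r in
    ((∀ i → + i ≤ℤ s → wr k p A (r + i) ≡ wr k p A r - + i)
      × (∀ i → 1 ≤ i → + i ≤ℤ s → seq k p A (r + n + i) ≡ 0))
    × (s <ℤ + q →
        (∀ i → s ≤ℤ + i → i ≤ q → wr k p A (r + i) ≡ + 0)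
          × (∀ i → s <ℤ + i → i ≤ q → seq k p A (r + n + i) ≡ 1))
    × (wr k p A (r + q) ≡ wr k p A r - s
        × block (seq k p A) (r + n) q ≡ replicate ∣ s ∣ 0 ++ replicate (q ∸ ∣ s ∣) 1)
proposition42p2 k p zero () A
proposition42p2 k p (suc n′) _ A lo hi r q _ ones rewrite Run.wr-start k p n′ A lo hi r q ones =
  (wr-decreases , emits-zeros) , after-zeros , (wr-end , output-block)
  where open Run k p n′ A lo hi r q ones
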